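{- Let $n\ge1$ and let $f=(\tau_1,\ldots,\tau_n)$ be a sequence of transpositions of $\{0,1,\ldots,n\}$ with $\tau_1\cdots\tau_n=(0\,1\,\cdots\,n)$ such that some factor equals $(0\,n)$. Then there is a unique $k$ with $\tau_k=(0\,n)$. Moreover, $\tau_k$ is the rightmost factor of $f$ moving $0$ (i.e. $\tau_i$ fixes $0$ for all $i>k$) and the leftmost factor of $f$ moving $n$ (i.e. $\tau_i$ fixes $n$ for all $i<k$).
   Context: Permutations are multiplied left to right: $\pi_1\pi_2$ maps $i$ to $\pi_2(\pi_1(i))$. -}

module Defs where

open import Data.Nat using (ℕ; zero; suc)
open import Data.Fin using (Fin; zero; suc; fromℕ; inject₁)
open import Data.Product using (Σ; _×_; proj₁; proj₂)
open import Relation.Binary.PropositionalEquality using (_≡_; _≢_)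
open import Data.Fin.Permutation using (Permutation′; id; _∘ₚ_; transpose; _≈_; _⟨$⟩ʳ_)

-- A sequence (τ₁,…,τₙ) of transpositions of {0,…,m}: each τᵢ is given by a
-- pair of distinct points (a , b) and denotes the transposition (a b).
TranspSeq : ℕ → ℕ → Set
TranspSeq n m = Fin n → Σ (Fin (suc m) × Fin (suc m)) (λ p → proj₁ p ≢ proj₂ p)

factor : ∀ {n m} → TranspSeq n m → Fin n → Permutation′ (suc m)
factor f i = transpose (proj₁ (proj₁ (f i))) (proj₂ (proj₁ (f i)))

-- product τ₁ τ₂ ⋯ τₙ, multiplied left to right (τ₁ applied first);
-- _∘ₚ_ satisfies (π₁ ∘ₚ π₂) ⟨$⟩ʳ i = π₂ ⟨$⟩ʳ (π₁ ⟨$⟩ʳ i).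
prod : ∀ {n m} → (Fin n → Permutation′ (suc m)) → Permutation′ (suc m)
prod {zero}  g = id
prod {suc n} g = g zero ∘ₚ prod (λ i → g (suc i))

-- the map of the (n+1)-cycle (0 1 ⋯ n): i ↦ i+1, n ↦ 0
cycleFun : ∀ n → Fin (suc n) → Fin (suc n)
cycleFun zero    zero    = zero
cycleFun (suc n) zero    = suc zero
cycleFun (suc n) (suc i) with cycleFun n i
... | zero  = zero
... | suc j = suc (suc j)

module Submission where

-- Read the factors τ₁,…,τₙ of f as the edges {a,b} of a multigraph
-- on the n+1 vertices {0,…,n}.  Following any point x through the product walks
-- along these edges from x to its image, so a product equal to the (n+1)-cycle
-- makes the graph connected.  A connected multigraph on N+1 vertices has at least
-- N edges (contract a non-loop edge and induct), hence ours, with exactly n edges,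
-- is a tree: no edge can be bypassed by a walk avoiding it.  All three claims are
-- then obtained by exhibiting such a forbidden bypass of a factor τᵢ:
--   * a second factor (0 n) would be bypassed by τₖ;
--   * if the first factor moving n came before k, the edge τₖ followed by the
--     later part of the trajectory of n (which ends at 0) would bypass it;
--   * if the last factor moving 0 came after k, the earlier part of the
--     trajectory of n (which ends at 0) followed by τₖ would bypass it.

open import Defs
open import Data.Nat using (ℕ; suc; _≥_; z≤n; s≤s)
open import Data.Fin using (Fin; zero; fromℕ; _<_)
open import Data.Product using (Σ; ∃; _×_)
open import Relation.Binary.PropositionalEquality using (_≡_; _≢_)
open import Data.Fin.Permutation using (_≈_; _⟨$⟩ʳ_; transpose)

import Data.Nat as ℕ
import Data.Nat.Properties as ℕₚ
open import Data.Fin using (suc; _≤_; _≟_; punchIn; punchOut; inject₁)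
open import Data.Fin.Properties
  using (punchInᵢ≢i; punchIn-punchOut; punchOut-punchIn; punchOut-cong; <⇒≢; all?; ¬∀⟶∃¬)
open import Data.Fin.Induction using (<-weakInduction)
open import Data.Fin.Permutation using (Permutation′; _⟨$⟩ˡ_; inverseˡ)
import Data.Fin.Permutation.Components as Components
open import Data.Product using (_,_; proj₁; proj₂; map)
open import Data.Empty using (⊥-elim)
open import Function using (_∘_)
open import Relation.Nullary using (¬_; Dec; yes; no)
open import Relation.Unary using (U)
open import Relation.Binary.PropositionalEquality
  using (refl; sym; trans; cong; subst; module ≡-Reasoning)

swap : ∀ {V} → Fin V → Fin V → Fin V → Fin V
swap = Components.transpose

swap-left : ∀ {V} (a b : Fin V) → swap a b a ≡ b
swap-left a b with a ≟ a
... | yes _  = refl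
... | no a≢a = ⊥-elim (a≢a refl)

swap-right : ∀ {V} (a b : Fin V) → a ≢ b → swap a b b ≡ a
swap-right a b a≢b with b ≟ a
... | yes b≡a = ⊥-elim (a≢b (sym b≡a))
... | no _ with b ≟ b
...   | yes _  = refl
...   | no b≢b = ⊥-elim (b≢b refl)

swap-other : ∀ {V} (a b x : Fin V) → x ≢ a → x ≢ b → swap a b x ≡ x
swap-other a b x x≢a x≢b with x ≟ a
... | yes x≡a = ⊥-elim (x≢a x≡a)
... | no _ with x ≟ b
...   | yes x≡b = ⊥-elim (x≢b x≡b)
...   | no _    = refl

swap-involutive : ∀ {V} (a b x : Fin V) → a ≢ b → swap a b (swap a b x) ≡ x
swap-involutive a b x a≢b = byCases (x ≟ a) (x ≟ b)
  where
  byCases : Dec (x ≡ a) → Dec (x ≡ b) → swap a b (swap a b x) ≡ x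
  byCases (yes refl) _          = trans (cong (swap x b) (swap-left x b)) (swap-right x b a≢b)
  byCases (no _)     (yes refl) = trans (cong (swap a x) (swap-right a x a≢b)) (swap-left a x)
  byCases (no x≢a)   (no x≢b)   = trans (cong (swap a b) (swap-other a b x x≢a x≢b)) (swap-other a b x x≢a x≢b)

data Joins {V : ℕ} : Fin V × Fin V → Fin V → Fin V → Set where
  forward  : ∀ {a b} → Joins (a , b) a b
  backward : ∀ {a b} → Joins (a , b) b a

joins-sym : ∀ {V} {p : Fin V × Fin V} {x z} → Joins p x z → Joins p z x
joins-sym forward  = backward
joins-sym backward = forward

joins-map : ∀ {V W} (g : Fin V → Fin W) {p x z} → Joins p x z → Joins (map g g p) (g x) (g z)
joins-map g forward  = forward
joins-map g backward = backward

swap-joins : ∀ {V} (a b x : Fin V) → swap a b x ≢ x → Joins (a , b) x (swap a b x)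
swap-joins a b x moved with x ≟ a
... | yes refl = forward
... | no _ with x ≟ b
...   | yes refl = backward
...   | no _     = ⊥-elim (moved refl)

data Walk {V m : ℕ} (e : Fin m → Fin V × Fin V) (P : Fin m → Set) : Fin V → Fin V → Set where
  []   : ∀ {x} → Walk e P x x
  step : ∀ {x z y} j → P j → Joins (e j) x z → Walk e P z y → Walk e P x y

Connected : ∀ {V m} → (Fin m → Fin V × Fin V) → Set
Connected e = ∀ x y → Walk e U x y

module _ {V m : ℕ} {e : Fin m → Fin V × Fin V} {P : Fin m → Set} where

  infixr 5 _++_
  _++_ : ∀ {x y w} → Walk e P x y → Walk e P y w → Walk e P x w
  []                ++ q = q
  (step j pj xz r) ++ q = step j pj xz (r ++ q)

  reverse : ∀ {x y} → Walk e P x y → Walk e P y x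
  reverse []                = []
  reverse (step j pj xz r) = reverse r ++ step j pj (joins-sym xz) []

  edge : ∀ {x z} j → P j → Joins (e j) x z → Walk e P x z
  edge j pj xz = step j pj xz []

  bypass : ∀ {p x z u v} → Joins p x z → Joins p u v → Walk e P u v → Walk e P x z
  bypass forward  forward  w = w
  bypass forward  backward w = reverse w
  bypass backward forward  w = reverse w
  bypass backward backward w = w

  weaken : ∀ {Q : Fin m → Set} → (∀ j → P j → Q j) → ∀ {x y} → Walk e P x y → Walk e Q x y
  weaken P⇒Q []                = []
  weaken P⇒Q (step j pj xz r) = step j (P⇒Q j pj) xz (weaken P⇒Q r)

reindex : ∀ {V m m′} {e : Fin m → Fin V × Fin V} {P : Fin m → Set} {Q : Fin m′ → Set}
  (h : Fin m′ → Fin m) → (∀ j → Q j → P (h j)) → ∀ {x y} → Walk (e ∘ h) Q x y → Walk e P x y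
reindex h Q⇒P []                = []
reindex h Q⇒P (step j qj xz r) = step (h j) (Q⇒P j qj) xz (reindex h Q⇒P r)

nonLoop : ∀ {V m} {e : Fin m → Fin V × Fin V} {P : Fin m → Set} {x y}
  → Walk e P x y → x ≢ y → ∃ λ j → proj₁ (e j) ≢ proj₂ (e j)
nonLoop []                 x≢x = ⊥-elim (x≢x refl)
nonLoop {e = e} (step j _ xz r) x≢y with proj₁ (e j) ≟ proj₂ (e j)
... | no loopFree = j , loopFree
nonLoop (step j _ forward  r) x≢y | yes a≡b = nonLoop r (x≢y ∘ trans a≡b)
nonLoop (step j _ backward r) x≢y | yes a≡b = nonLoop r (x≢y ∘ trans (sym a≡b))

-- Contracting a non-loop edge j = (a , b): the vertex b is merged into a, the
-- remaining vertices renumbered, and edge j deleted.  Connectivity survives.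
module Contraction {N m : ℕ} (e : Fin (suc m) → Fin (suc (suc N)) × Fin (suc (suc N)))
                   (j : Fin (suc m)) (loopFree : proj₁ (e j) ≢ proj₂ (e j)) where

  private
    a b : Fin (suc (suc N))
    a = proj₁ (e j)
    b = proj₂ (e j)

  merge : Fin (suc (suc N)) → Fin (suc N)
  merge x with b ≟ x
  ... | yes _   = punchOut (loopFree ∘ sym)
  ... | no b≢x = punchOut b≢x

  merge-ends : merge a ≡ merge b
  merge-ends with b ≟ b
  ... | no b≢b = ⊥-elim (b≢b refl)
  ... | yes _ with b ≟ a
  ...   | yes _ = refl
  ...   | no _  = punchOut-cong b refl

  merge-punchIn : ∀ x → merge (punchIn b x) ≡ x
  merge-punchIn x with b ≟ punchIn b x
  ... | yes b≡x = ⊥-elim (punchInᵢ≢i b x (sym b≡x))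
  ... | no _    = trans (punchOut-cong b refl) (punchOut-punchIn b)

  merge-joined : ∀ {x z} → Joins (e j) x z → merge x ≡ merge z
  merge-joined forward  = merge-ends
  merge-joined backward = sym merge-ends

  contracted : Fin m → Fin (suc N) × Fin (suc N)
  contracted k = map merge merge (e (punchIn j k))

  contractWalk : ∀ {x y} → Walk e U x y → Walk contracted U (merge x) (merge y)
  contractWalk [] = []
  contractWalk {x} {y} (step {z = z} l _ xz r) with j ≟ l
  ... | yes refl = subst (λ w → Walk contracted U w (merge y)) (sym (merge-joined xz)) (contractWalk r)
  ... | no j≢l  = step (punchOut j≢l) _ xz′ (contractWalk r)
    where
    xz′ : Joins (contracted (punchOut j≢l)) (merge x) (merge z)
    xz′ = subst (λ l′ → Joins (map merge merge (e l′)) (merge x) (merge z))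
                (sym (punchIn-punchOut j≢l)) (joins-map merge xz)

  contract-connected : Connected e → Connected contracted
  contract-connected conn x y =
    subst₂ (merge-punchIn x) (merge-punchIn y) (contractWalk (conn (punchIn b x) (punchIn b y)))
    where
    subst₂ : ∀ {u u′ v v′} → u ≡ u′ → v ≡ v′ → Walk contracted U u v → Walk contracted U u′ v′
    subst₂ refl refl w = w

edgeBound : ∀ N m (e : Fin m → Fin (suc N) × Fin (suc N)) → Connected e → N ℕ.≤ m
edgeBound ℕ.zero m e conn = z≤n
edgeBound (suc N) m e conn with nonLoop (conn zero (suc zero)) (λ ())
edgeBound (suc N) (suc m) e conn | j , loopFree =
  s≤s (edgeBound N m contracted (contract-connected conn))
  where open Contraction e j loopFree
edgeBound (suc N) ℕ.zero e conn | () , _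

treeEdgeIsBridge : ∀ {m} (e : Fin (suc m) → Fin (suc (suc m)) × Fin (suc (suc m)))
  → Connected e → ∀ i {x z} → Joins (e i) x z → ¬ Walk e (_≢ i) x z
treeEdgeIsBridge {m} e conn i xz avoiding = ℕₚ.1+n≰n (edgeBound (suc m) m (e ∘ punchIn i) conn′)
  where
  reroute : ∀ {u v} → Walk e U u v → Walk e (_≢ i) u v
  reroute [] = []
  reroute (step l _ uw r) with l ≟ i
  ... | yes refl = bypass uw xz avoiding ++ reroute r
  ... | no l≢i  = step l l≢i uw (reroute r)

  deleteEdge : ∀ {u v} → Walk e (_≢ i) u v → Walk (e ∘ punchIn i) U u v
  deleteEdge [] = []
  deleteEdge (step l l≢i uw r) =
    step (punchOut i≢l) _ (subst (λ l′ → Joins (e l′) _ _) (sym (punchIn-punchOut i≢l)) uw) (deleteEdge r)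
    where
    i≢l : i ≢ l
    i≢l = l≢i ∘ sym

  conn′ : Connected (e ∘ punchIn i)
  conn′ x y = deleteEdge (reroute (conn x y))

module Trajectory {m : ℕ} where

  edges : ∀ {n} → TranspSeq n m → Fin n → Fin (suc m) × Fin (suc m)
  edges f i = proj₁ (f i)

  move : ∀ {n} → TranspSeq n m → Fin n → Fin (suc m) → Fin (suc m)
  move f i x = factor f i ⟨$⟩ʳ x

  image : ∀ {n} → TranspSeq n m → Fin (suc m) → Fin (suc m)
  image f x = prod (factor f) ⟨$⟩ʳ x

  tail : ∀ {n} → TranspSeq (suc n) m → TranspSeq n m
  tail f = f ∘ suc

  move-involutive : ∀ {n} (f : TranspSeq n m) i x → move f i (move f i x) ≡ x
  move-involutive f i x = swap-involutive _ _ x (proj₂ (f i))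

  move-joins : ∀ {n} (f : TranspSeq n m) i {x} → move f i x ≢ x → Joins (edges f i) x (move f i x)
  move-joins f i {x} = swap-joins _ _ x

  stepBack : ∀ {n} (f : TranspSeq n m) {P : Fin n → Set} i {x y}
    → P i → Walk (edges f) P (move f i x) y → Walk (edges f) P x y
  stepBack f i {x} pi w with move f i x ≟ x
  ... | yes fixed = subst (λ u → Walk (edges f) _ u _) fixed w
  ... | no moved  = step i pi (move-joins f i moved) w

  shift : ∀ {n} (f : TranspSeq (suc n) m) {P : Fin n → Set} {Q : Fin (suc n) → Set}
    → (∀ j → P j → Q (suc j)) → ∀ {x y} → Walk (edges (tail f)) P x y → Walk (edges f) Q x y
  shift f = reindex suc

  trajectory : ∀ {n} (f : TranspSeq n m) x → Walk (edges f) U x (image f x)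
  trajectory {ℕ.zero} f x = []
  trajectory {suc n}  f x = stepBack f zero _ (shift f _ (trajectory (tail f) (move f zero x)))

  image-fixed : ∀ {n} (f : TranspSeq n m) y → (∀ j → move f j y ≡ y) → image f y ≡ y
  image-fixed {ℕ.zero} f y fixed = refl
  image-fixed {suc n}  f y fixed =
    trans (cong (image (tail f)) (fixed zero)) (image-fixed (tail f) y (fixed ∘ suc))

  image-injective : ∀ {n} (f : TranspSeq n m) {x y} → image f x ≡ image f y → x ≡ y
  image-injective f {x} {y} eq = begin
    x                  ≡⟨ sym (inverseˡ π) ⟩
    π ⟨$⟩ˡ (π ⟨$⟩ʳ x)  ≡⟨ cong (π ⟨$⟩ˡ_) eq ⟩
    π ⟨$⟩ˡ (π ⟨$⟩ʳ y)  ≡⟨ inverseˡ π ⟩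
    y                  ∎
    where
    open ≡-Reasoning
    π : Permutation′ (suc m)
    π = prod (factor f)

  firstMover : ∀ {n} (f : TranspSeq n m) x i → move f i x ≢ x
    → ∃ λ i₀ → i₀ ≤ i × move f i₀ x ≢ x × Walk (edges f) (i₀ <_) (move f i₀ x) (image f x)
  firstMover {suc n} f x i moved with move f zero x ≟ x | i
  ... | no moved₀ | _ =
    zero , z≤n , moved₀ , shift f (λ _ _ → s≤s z≤n) (trajectory (tail f) (move f zero x))
  ... | yes fixed₀ | zero = ⊥-elim (moved fixed₀)
  ... | yes fixed₀ | suc i′ with firstMover (tail f) x i′ moved
  ...   | i₀ , i₀≤i′ , moved₀ , w =
    suc i₀ , s≤s i₀≤i′ , moved₀ ,
    subst (Walk (edges f) _ _) (cong (image (tail f)) (sym fixed₀)) (shift f (λ _ → s≤s) w)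

  prependFirst : ∀ {n} (f : TranspSeq (suc n) m) {x y} (i₀ : Fin n)
    → Walk (edges (tail f)) (_< i₀) (move f zero x) y → Walk (edges f) (_< suc i₀) x y
  prependFirst f i₀ w = stepBack f zero (s≤s z≤n) (shift f (λ _ → s≤s) w)

  lastMover : ∀ {n} (f : TranspSeq n m) x {y} → image f x ≡ y → ∀ i → move f i y ≢ y
    → ∃ λ i₀ → i ≤ i₀ × move f i₀ y ≢ y × Walk (edges f) (_< i₀) x (move f i₀ y)
  lastMover {suc n} f x img (suc i) moved with lastMover (tail f) (move f zero x) img i moved
  ... | i₀ , i≤i₀ , moved₀ , w = suc i₀ , s≤s i≤i₀ , moved₀ , prependFirst f i₀ w
  lastMover {suc n} f x {y} img zero moved with all? (λ j → move (tail f) j y ≟ y)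
  ... | yes tailFixes = zero , z≤n , moved , subst (Walk (edges f) _ x) x≡τ₀y []
    where
    τ₀x≡y : move f zero x ≡ y
    τ₀x≡y = image-injective (tail f) (trans img (sym (image-fixed (tail f) y tailFixes)))
    x≡τ₀y : x ≡ move f zero y
    x≡τ₀y = trans (sym (move-involutive f zero x)) (cong (move f zero) τ₀x≡y)
  ... | no tailMoves with ¬∀⟶∃¬ n _ (λ j → move (tail f) j y ≟ y) tailMoves
  ...   | j , movedⱼ with lastMover (tail f) (move f zero x) img j movedⱼ
  ...     | i₀ , _ , moved₀ , w = suc i₀ , z≤n , moved₀ , prependFirst f i₀ w

open Trajectory

cycle-inject₁ : ∀ n (i : Fin n) → cycleFun n (inject₁ i) ≡ suc i
cycle-inject₁ (suc n) zero = refl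
cycle-inject₁ (suc n) (suc i) with cycleFun n (inject₁ i) | cycle-inject₁ n i
... | _ | refl = refl

cycle-last : ∀ n → cycleFun n (fromℕ n) ≡ zero
cycle-last ℕ.zero = refl
cycle-last (suc n) with cycleFun n (fromℕ n) | cycle-last n
... | _ | refl = refl

-- If the product is the (n+1)-cycle, the graph of the factors is connected:
-- the trajectory of i reaches i+1, so every vertex is reached from 0.
cycle-connected : ∀ n (f : TranspSeq n n) → (∀ i → image f i ≡ cycleFun n i) → Connected (edges f)
cycle-connected n f isCycle x y = reverse (fromZero x) ++ fromZero y
  where
  fromZero : ∀ x → Walk (edges f) U zero x
  fromZero = <-weakInduction (Walk (edges f) U zero) []
    (λ i w → w ++ subst (Walk (edges f) U (inject₁ i)) (trans (isCycle (inject₁ i)) (cycle-inject₁ n i))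
                           (trajectory f (inject₁ i)))

-- The situation of the theorem (with n+1 in place of n ≥ 1): the product of f
-- is the cycle (0 1 ⋯ n+1) and the factor τₖ is (0 n+1).
module CycleFactorisation (n : ℕ) (f : TranspSeq (suc n) (suc n))
  (isCycle : ∀ i → image f i ≡ cycleFun (suc n) i)
  (k : Fin (suc n)) (τₖ≈ : factor f k ≈ transpose zero (fromℕ (suc n))) where

  private
    last : Fin (suc (suc n))
    last = fromℕ (suc n)

  bridge : ∀ i {x z} → Joins (edges f i) x z → ¬ Walk (edges f) (_≢ i) x z
  bridge = treeEdgeIsBridge (edges f) (cycle-connected (suc n) f isCycle)

  zero-last-edge : ∀ j → factor f j ≈ transpose zero last → Joins (edges f j) zero last
  zero-last-edge j τⱼ≈ = subst (Joins (edges f j) zero) τⱼ0≡last (move-joins f j τⱼ-moves-0)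
    where
    τⱼ0≡last : move f j zero ≡ last
    τⱼ0≡last = trans (τⱼ≈ zero) (swap-left zero last)
    τⱼ-moves-0 : move f j zero ≢ zero
    τⱼ-moves-0 τⱼ0≡0 with trans (sym τⱼ0≡0) τⱼ0≡last
    ... | ()

  image-last : image f last ≡ zero
  image-last = trans (isCycle last) (cycle-last (suc n))

  -- Another factor (0 n+1) would be bypassed by τₖ.
  unique : ∀ j → factor f j ≈ transpose zero last → j ≡ k
  unique j τⱼ≈ with j ≟ k
  ... | yes j≡k = j≡k
  ... | no j≢k  = ⊥-elim (bridge j (zero-last-edge j τⱼ≈) (edge k (j≢k ∘ sym) (zero-last-edge k τₖ≈)))

  -- A first mover i₀ < k of n+1 would be bypassed by τₖ followed by the rest of
  -- the trajectory of n+1, which ends at 0.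
  last-fixed-before : ∀ i → i < k → move f i last ≡ last
  last-fixed-before i i<k with move f i last ≟ last
  ... | yes fixed = fixed
  ... | no moved with firstMover f last i moved
  ...   | i₀ , i₀≤i , moved₀ , rest = ⊥-elim (bridge i₀ (move-joins f i₀ moved₀) detour)
    where
    i₀<k : i₀ < k
    i₀<k = ℕₚ.≤-<-trans i₀≤i i<k
    detour : Walk (edges f) (_≢ i₀) last (move f i₀ last)
    detour = edge k (<⇒≢ i₀<k ∘ sym) (joins-sym (zero-last-edge k τₖ≈))
          ++ reverse (weaken (λ _ i₀<j → <⇒≢ i₀<j ∘ sym) (subst (Walk (edges f) _ _) image-last rest))

  -- A last mover i₀ > k of 0 would be bypassed by τₖ followed by the trajectory
  -- of n+1 (whose image is 0) up to i₀.
  zero-fixed-after : ∀ i → k < i → move f i zero ≡ zero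
  zero-fixed-after i k<i with move f i zero ≟ zero
  ... | yes fixed = fixed
  ... | no moved with lastMover f last image-last i moved
  ...   | i₀ , i≤i₀ , moved₀ , before = ⊥-elim (bridge i₀ (move-joins f i₀ moved₀) detour)
    where
    k<i₀ : k < i₀
    k<i₀ = ℕₚ.<-≤-trans k<i i≤i₀
    detour : Walk (edges f) (_≢ i₀) zero (move f i₀ zero)
    detour = edge k (<⇒≢ k<i₀) (zero-last-edge k τₖ≈) ++ weaken (λ _ → <⇒≢) before

lemma4p3 : (n : ℕ) → n ≥ 1 → (f : TranspSeq n n)
    → (∀ i → prod (factor f) ⟨$⟩ʳ i ≡ cycleFun n i)
    → (∃ λ k → factor f k ≈ transpose zero (fromℕ n))
    → ∃ λ k → (factor f k ≈ transpose zero (fromℕ n))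
        × (∀ j → factor f j ≈ transpose zero (fromℕ n) → j ≡ k)
        × (∀ i → k < i → factor f i ⟨$⟩ʳ zero ≡ zero)
        × (∀ i → i < k → factor f i ⟨$⟩ʳ fromℕ n ≡ fromℕ n)
lemma4p3 ℕ.zero () f isCycle _
lemma4p3 (suc n) _ f isCycle (k , τₖ≈) =
  k , τₖ≈ , unique , zero-fixed-after , last-fixed-before
  where open CycleFactorisation n f isCycle k τₖ≈
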